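{- Let $G=(V,E^+,E^-)$ be a complete signed graph and $F$ a set of vertex pairs. For distinct vertices $x,w$ define $p_{xw}=1$ if $xw\in E^+\setminus F$, $p_{xw}=1/4$ if $xw\in E^+\cap F$, $p_{xw}=3/4$ if $xw\in E^-\cap F$, and $p_{xw}=0$ if $xw\in E^-\setminus F$. For distinct $u,v,w$ define $d(u,v\mid w)=p_{uw}+p_{vw}-2p_{uw}p_{vw}$ if $uv\in E^+$ and $d(u,v\mid w)=p_{uw}p_{vw}$ if $uv\in E^-$; and $b(u,v\mid w)=p_{uw}+p_{vw}-p_{uw}p_{vw}$ if $uv\in F$ and $b(u,v\mid w)=0$ otherwise. Then for every triple of distinct vertices $u,v,w$ that either is not a bad triangle or has at least one of its three pairs in $F$, $$d(u,v\mid w)+d(u,w\mid v)+d(v,w\mid u)\le \tfrac{3}{2}\big(b(u,v\mid w)+b(u,w\mid v)+b(v,w\mid u)\big).$$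
   Context: A complete signed graph has every pair of distinct vertices in exactly one of $E^+$ (positive) or $E^-$ (negative). A bad triangle is a triple of vertices among whose three pairs exactly one is negative. -}

module Defs where

open import Data.Bool using (Bool; true; false; _∧_; not)
open import Data.Integer using (+_)
open import Data.Nat using (ℕ) renaming (_+_ to _+ℕ_)
open import Data.Rational using (ℚ; _/_; _+_; _*_; _-_; _≤_; 0ℚ; 1ℚ)
open import Data.Product using (_×_)
open import Data.Sum using (_⊎_)
open import Relation.Nullary using (¬_)
open import Relation.Binary.PropositionalEquality using (_≡_)

-- A complete signed graph on vertex type V: every pair of distinct
-- vertices is either positive (sign = true, in E⁺) or negative
-- (sign = false, in E⁻), symmetrically.
record SignedGraph (V : Set) : Set where
  field
    pos     : V → V → Bool
    pos-sym : ∀ x y → pos x y ≡ pos y x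

Symmetric : {V : Set} → (V → V → Bool) → Set
Symmetric {V} F = ∀ (x y : V) → F x y ≡ F y x

module _ {V : Set} (G : SignedGraph V) (F : V → V → Bool) where
  open SignedGraph G

  pval : Bool → Bool → ℚ
  pval true  false = 1ℚ
  pval true  true  = + 1 / 4
  pval false true  = + 3 / 4
  pval false false = 0ℚ

  p : V → V → ℚ
  p x w = pval (pos x w) (F x w)

  d : V → V → V → ℚ
  d u v w with pos u v
  ... | true  = p u w + p v w - (+ 2 / 1) * p u w * p v w
  ... | false = p u w * p v w

  b : V → V → V → ℚ
  b u v w with F u v
  ... | true  = p u w + p v w - p u w * p v w
  ... | false = 0ℚ

  negCount : V → V → V → ℕ
  negCount u v w = neg (pos u v) +ℕ neg (pos u w) +ℕ neg (pos v w)
    where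
    neg : Bool → ℕ
    neg true  = 0
    neg false = 1

  BadTriangle : V → V → V → Set
  BadTriangle u v w = negCount u v w ≡ 1

  SomePairInF : V → V → V → Set
  SomePairInF u v w = (F u v ≡ true) ⊎ ((F u w ≡ true) ⊎ (F v w ≡ true))

{-# OPTIONS --safe #-}
module Submission where

-- The three d-terms, the three b-terms and the bad-triangle condition of a
-- triple depend only on the labels (sign, membership in F) of its three
-- pairs.  Once rewritten as functions of these labels, the inequality is a
-- closed statement about 4³ = 64 label triples with rational weights, which
-- is decided by evaluation.

open import Defs
open import Data.Bool using (Bool; true; false)
open import Data.Bool.Properties using () renaming (_≟_ to _≟ᴮ_)
open import Data.Integer using (+_)
open import Data.Nat using (ℕ) renaming (_+_ to _+ℕ_; _≟_ to _≟ℕ_)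
open import Data.Product using (_×_; _,_; proj₁; proj₂)
open import Data.Rational using (ℚ; _/_; _+_; _*_; _-_; _≤_; _≤?_; 0ℚ; 1ℚ)
open import Data.Sum using (_⊎_; map₁)
open import Function using (_∘_)
open import Relation.Nullary using (¬_; Dec)
open import Relation.Nullary.Decidable using (from-yes; map′; ¬?; _×-dec_; _⊎-dec_; _→-dec_)
open import Relation.Binary.PropositionalEquality using (_≡_; refl; cong₂; subst; subst₂; sym)

∀-Bool? : {P : Bool → Set} → (∀ b → Dec (P b)) → Dec (∀ b → P b)
∀-Bool? P? = map′ (λ { (t , f) true → t ; (t , f) false → f })
                  (λ h → h true , h false)
                  (P? true ×-dec P? false)

-- (sign, membership in F) of a pair
Label : Set
Label = Bool × Bool

∀-Label? : {P : Label → Set} → (∀ ℓ → Dec (P ℓ)) → Dec (∀ ℓ → P ℓ)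
∀-Label? P? = map′ (λ h (s , f) → h s f) (λ h s f → h (s , f))
                   (∀-Bool? λ s → ∀-Bool? λ f → P? (s , f))

weight : Label → ℚ
weight (true  , false) = 1ℚ
weight (true  , true)  = + 1 / 4
weight (false , true)  = + 3 / 4
weight (false , false) = 0ℚ

dSign : Bool → ℚ → ℚ → ℚ
dSign true  x y = x + y - (+ 2 / 1) * x * y
dSign false x y = x * y

bInF : Bool → ℚ → ℚ → ℚ
bInF true  x y = x + y - x * y
bInF false x y = 0ℚ

negative : Bool → ℕ
negative true  = 0
negative false = 1

module _ (ℓ₁ ℓ₂ ℓ₃ : Label) where
  private
    w₁ w₂ w₃ : ℚ
    w₁ = weight ℓ₁
    w₂ = weight ℓ₂
    w₃ = weight ℓ₃

  apexSum : (Bool → ℚ → ℚ → ℚ) → (Label → Bool) → ℚ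
  apexSum g σ = g (σ ℓ₁) w₂ w₃ + g (σ ℓ₂) w₁ w₃ + g (σ ℓ₃) w₁ w₂

  triangleD : ℚ
  triangleD = apexSum dSign proj₁

  triangleB : ℚ
  triangleB = apexSum bInF proj₂

  negatives : ℕ
  negatives = negative (proj₁ ℓ₁) +ℕ negative (proj₁ ℓ₂) +ℕ negative (proj₁ ℓ₃)

  Admissible : Set
  Admissible = ¬ (negatives ≡ 1) ⊎ (proj₂ ℓ₁ ≡ true ⊎ (proj₂ ℓ₂ ≡ true ⊎ proj₂ ℓ₃ ≡ true))

  LabelInequality : Set
  LabelInequality = Admissible → triangleD ≤ (+ 3 / 2) * triangleB

  labelInequality? : Dec LabelInequality
  labelInequality? =
    (¬? (negatives ≟ℕ 1) ⊎-dec (proj₂ ℓ₁ ≟ᴮ true ⊎-dec (proj₂ ℓ₂ ≟ᴮ true ⊎-dec proj₂ ℓ₃ ≟ᴮ true)))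
      →-dec (triangleD ≤? (+ 3 / 2) * triangleB)

labelInequality : ∀ ℓ₁ ℓ₂ ℓ₃ → LabelInequality ℓ₁ ℓ₂ ℓ₃
labelInequality = from-yes (∀-Label? λ ℓ₁ → ∀-Label? λ ℓ₂ → ∀-Label? λ ℓ₃ → labelInequality? ℓ₁ ℓ₂ ℓ₃)

module _ {V : Set} (G : SignedGraph V) (F : V → V → Bool) where
  open SignedGraph G

  label : V → V → Label
  label x y = pos x y , F x y

  p≡weight : ∀ x y → p G F x y ≡ weight (label x y)
  p≡weight x y with pos x y | F x y
  ... | true  | true  = refl
  ... | true  | false = refl
  ... | false | true  = refl
  ... | false | false = refl

  p-sym : Symmetric F → ∀ x y → p G F x y ≡ p G F y x
  p-sym F-sym x y = cong₂ (pval G F) (pos-sym x y) (F-sym x y)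

  d≡dSign : ∀ u v w → d G F u v w ≡ dSign (pos u v) (p G F u w) (p G F v w)
  d≡dSign u v w with pos u v
  ... | true  = refl
  ... | false = refl

  b≡bInF : ∀ u v w → b G F u v w ≡ bInF (F u v) (p G F u w) (p G F v w)
  b≡bInF u v w with F u v
  ... | true  = refl
  ... | false = refl

  negCount≡negatives : ∀ u v w →
    negCount G F u v w ≡ negatives (label u v) (label u w) (label v w)
  negCount≡negatives u v w with pos u v | pos u w | pos v w
  ... | true  | true  | true  = refl
  ... | true  | true  | false = refl
  ... | true  | false | true  = refl
  ... | true  | false | false = refl
  ... | false | true  | true  = refl
  ... | false | true  | false = refl
  ... | false | false | true  = refl
  ... | false | false | false = refl

  module _ (F-sym : Symmetric F) (g : Bool → ℚ → ℚ → ℚ) (σ : Label → Bool)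
           (t : V → V → V → ℚ)
           (t≡g : ∀ u v w → t u v w ≡ g (σ (label u v)) (p G F u w) (p G F v w)) where

    apexSum-label : ∀ u v w →
      t u v w + t u w v + t v w u ≡ apexSum (label u v) (label u w) (label v w) g σ
    apexSum-label u v w
      rewrite t≡g u v w | t≡g u w v | t≡g v w u
            | p-sym F-sym w v | p-sym F-sym v u | p-sym F-sym w u
            | p≡weight u v | p≡weight u w | p≡weight v w
      = refl

lemma8 : {V : Set} (G : SignedGraph V) (F : V → V → Bool) → Symmetric F →
    (u v w : V) → ¬ (u ≡ v) → ¬ (u ≡ w) → ¬ (v ≡ w) →
    (¬ BadTriangle G F u v w) ⊎ SomePairInF G F u v w →
    d G F u v w + d G F u w v + d G F v w u
    ≤ (+ 3 / 2) * (b G F u v w + b G F u w v + b G F v w u)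
lemma8 G F F-sym u v w _ _ _ admissible =
  subst₂ (λ D B → D ≤ (+ 3 / 2) * B)
    (sym (apexSum-label G F F-sym dSign proj₁ (d G F) (d≡dSign G F) u v w))
    (sym (apexSum-label G F F-sym bInF  proj₂ (b G F) (b≡bInF G F) u v w))
    (labelInequality (label G F u v) (label G F u w) (label G F v w) admissible′)
  where
  admissible′ : Admissible (label G F u v) (label G F u w) (label G F v w)
  admissible′ =
    map₁ (λ notBad → notBad ∘ subst (_≡ 1) (sym (negCount≡negatives G F u v w))) admissible
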